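{- Let $k,n\in\mathbb{N}$ with $k\le n$, and let $\mathcal{A}=\{\{i,i+1,\ldots,i+k-1\}: i\in[n]\}\subseteq\binom{[n]}{k}$, with indices taken cyclically modulo $n$ (in $\{1,\ldots,n\}$). Let $G_{\mathcal{A}}$ be the graph on vertex set $\mathcal{A}$ with edge set $\{(S,S'): S\cap S'\neq\emptyset\}$ (including self-loops). Consider the test $\mathcal{T}$ which, on input $F\in\mathcal{F}_{\mathcal{A}}$, picks $S\in\mathcal{A}$ uniformly at random, then picks $S'\in\mathcal{A}$ uniformly at random among those with $S\cap S'\neq\emptyset$, and accepts iff $F(S)|_{S\cap S'}=F(S')|_{S\cap S'}$. Let $\varepsilon\ge0$ and $F\in\mathcal{F}_{\mathcal{A}}$. If $F$ passes $\mathcal{T}$ with probability $1-\varepsilon$, then $F$ is $(1-4\varepsilon)$-close to $\mathrm{dec}(F)$.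
   Context: For $V\subseteq\mathcal{P}([n])$, $\mathcal{F}_V$ is the set of all maps $F$ assigning to each $S\in V$ a function $F(S)\in\{0,1\}^S$. For $a\in\{0,1\}^n$, $\mathrm{DP}_V(a)\in\mathcal{F}_V$ is given by $\mathrm{DP}_V(a)(S)=a|_S$. For $F,H\in\mathcal{F}_V$, $\Delta(F,H)=|\{S\in V: F(S)\neq H(S)\}|/|V|$, and $F$ is $(1-\delta)$-close to $H$ if $\Delta(F,H)\le\delta$. For $F\in\mathcal{F}_V$, $a^F_i$ is the majority value of $F(S)_i$ over all $S\in V$ containing $i$, and $\mathrm{dec}(F)=\mathrm{DP}_V(a^F)$. -}

module Defs where

open import Data.Bool using (Bool; true; false; not; _∧_; _∨_; if_then_else_)
open import Data.Bool.Properties using () renaming (_≟_ to _≟ᵇ_)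
open import Data.Nat as ℕ using (ℕ; zero; suc; _≤ᵇ_; _<ᵇ_)
open import Data.Fin using (Fin; toℕ)
open import Data.Fin.Subset using (Subset; _∩_; inside)
open import Data.Vec using (Vec; lookup; tabulate)
open import Data.Vec.Properties using (≡-dec)
open import Data.List using (List; []; _∷_; map; length; deduplicate; allFin; foldr)
open import Data.Bool.ListAction using (all; any)
open import Data.Integer using (+_)
open import Data.Rational using (ℚ; 0ℚ; _+_; _*_; _/_)
open import Relation.Binary.PropositionalEquality using (_≡_)

_==_ : Bool → Bool → Bool
true  == b = b
false == b = not b

-- The cyclic interval {i, i+1, ..., i+k-1} (mod n) as a subset of Fin n
-- (elements 0..n-1 stand for 1..n). j is in it iff
--   i ≤ j < i + k   or   j + n < i + k   (wrap-around part).
interval : (n k : ℕ) → Fin n → Subset n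
interval n k i = tabulate λ j →
  ((toℕ i ≤ᵇ toℕ j) ∧ (toℕ j <ᵇ (toℕ i ℕ.+ k))) ∨ ((toℕ j ℕ.+ n) <ᵇ (toℕ i ℕ.+ k))

-- The family A = { S_i : i ∈ [n] } as a SET: duplicates removed
-- (relevant when k = n, where all S_i coincide).
𝒜 : (n k : ℕ) → List (Subset n)
𝒜 n k = deduplicate (≡-dec _≟ᵇ_) (map (interval n k) (allFin n))

_∈ᵇ_ : ∀ {n} → Fin n → Subset n → Bool
j ∈ᵇ S = lookup S j

meets : ∀ {n} → Subset n → Subset n → Bool
meets {n} S S' = any (λ j → j ∈ᵇ (S ∩ S')) (allFin n)

agreeOn : ∀ {n} → Subset n → (Fin n → Bool) → (Fin n → Bool) → Bool
agreeOn {n} T f g = all (λ j → not (j ∈ᵇ T) ∨ (f j == g j)) (allFin n)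

-- An element of F_V: to each S a function; only its values on S matter
-- (F(S) ∈ {0,1}^S is represented by a total function read on S only).
Assignment : ℕ → Set
Assignment n = Subset n → (Fin n → Bool)

-- DP_V(a)(S) = a|_S
DP : ∀ {n} → (Fin n → Bool) → Assignment n
DP a S = a

countB : ∀ {A : Set} → (A → Bool) → List A → ℕ
countB p [] = 0
countB p (x ∷ xs) = if p x then suc (countB p xs) else countB p xs

sumℚ : ∀ {A : Set} → (A → ℚ) → List A → ℚ
sumℚ f = foldr (λ x acc → f x + acc) 0ℚ

-- a / b as a rational (denominators used below are always positive
-- under the theorem's hypotheses; b = 0 gives 0 by convention)
frac : ℕ → ℕ → ℚ
frac a zero    = 0ℚ
frac a (suc b) = (+ a) / suc b

dist : ∀ {n} → List (Subset n) → Assignment n → Assignment n → ℚ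
dist V F H = frac (countB (λ S → not (agreeOn S (F S) (H S))) V) (length V)

acceptProb : ∀ {n} → List (Subset n) → Assignment n → ℚ
acceptProb V F =
  frac 1 (length V) *
  sumℚ (λ S → frac (countB (λ S' → meets S S' ∧ agreeOn (S ∩ S') (F S) (F S')) V)
                   (countB (λ S' → meets S S') V)) V

-- a is a majority decoding of F on V: for each i, the value a i is taken by
-- F(S)_i for at least as many S ∈ V containing i as the opposite value
-- (any tie-breaking is allowed).
IsMajority : ∀ {n} → List (Subset n) → Assignment n → (Fin n → Bool) → Set
IsMajority V F a = ∀ i →
  countB (λ S → (i ∈ᵇ S) ∧ not (F S i == a i)) V ℕ.≤ countB (λ S → (i ∈ᵇ S) ∧ (F S i == a i)) V

-- If F(S) disagrees with a on some i ∈ S, then every S' ∋ i with F(S')_i = a_i meets S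
-- but is inconsistent with it, and by the choice of a these S' make up at least half of
-- the sets through i.  For cyclic intervals every S meets at most 2k intervals (each one
-- through the start of S or starting inside S) while exactly k intervals pass through
-- each point, so such an S is rejected by the second step of the test with probability
-- at least 1/4.  Averaging over S gives Δ(F, dec F) ≤ 4ε.
module Submission where

open import Defs

module DirectProductTesting where

  open import Data.Bool using (Bool; true; false; not; _∧_; _∨_; T)
  open import Data.Bool.Properties using (T-∧; T-∨; T-≡; T-not-≡) renaming (_≟_ to _≟ᵇ_)
  open import Data.Empty using (⊥; ⊥-elim)
  import Data.Integer as ℤ
  import Data.Integer.Properties as ℤ
  open import Data.Fin using (Fin; zero; suc; toℕ; fromℕ<)
  open import Data.Fin.Properties as Fin using (toℕ<n; toℕ-fromℕ<)
  open import Data.Fin.Subset using (Subset; _∩_)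
  open import Data.List using (List; []; _∷_; _∷ʳ_; map; length; tabulate; allFin; upTo; applyUpTo; filter; deduplicate)
  open import Data.List.Properties using (upTo-∷ʳ; map-tabulate; filter-all; filter-none)
  open import Data.List.Membership.Propositional using (_∈_; lose)
  open import Data.List.Membership.Propositional.Properties using (∈-allFin; ∈-map⁻)
  open import Data.List.Relation.Unary.All as All using (All)
  open import Data.List.Relation.Unary.All.Properties as All using (all⁺; all⁻; ¬All⇒Any¬; deduplicate⁺)
  open import Data.List.Relation.Unary.Unique.Propositional using (Unique)
  open import Data.List.Relation.Unary.Unique.Propositional.Properties as Unique using (allFin⁺)
  open import Data.List.Relation.Unary.AllPairs using ([]; _∷_)
  open import Data.List.Relation.Unary.Any using (here; there; satisfied)
  open import Data.List.Relation.Unary.Any.Properties using (any⁺; any⁻)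
  open import Data.Nat using (ℕ; zero; suc; _+_; _*_; _∸_; _⊓_; _≤_; _<_; _≤ᵇ_; _<ᵇ_; z≤n; s≤s; s≤s⁻¹)
  open import Data.Nat.Properties
  open import Data.Nat.Solver using (module +-*-Solver)
  open import Algebra.Properties.CommutativeSemigroup +-commutativeSemigroup using (interchange)
  import Data.Rational as ℚ
  import Data.Rational.Properties as ℚ
  open import Data.Rational using (ℚ; 0ℚ; 1ℚ; _/_; toℚᵘ)
  import Data.Rational.Solver as ℚ
  import Data.Rational.Unnormalised as ℚᵘ
  import Data.Rational.Unnormalised.Properties as ℚᵘ
  open import Data.Product using (_×_; _,_; proj₁; proj₂; ∃)
  open import Data.Sum as Sum using (_⊎_; inj₁; inj₂)
  open import Data.Unit using (tt)
  open import Data.Vec as Vec using (lookup)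
  open import Data.Vec.Properties using (lookup∘tabulate; lookup-zipWith; tabulate∘lookup; tabulate-cong; ≡-dec)
  open import Function using (id; _∘_; _⇔_; Equivalence)
  open import Relation.Binary.PropositionalEquality
  open import Relation.Binary.Definitions using (DecidableEquality; tri<; tri≈; tri>)
  open import Relation.Nullary using (yes; no; ¬?)
  open import Relation.Nullary.Decidable using (T?)

  bit : Bool → ℕ
  bit false = 0
  bit true  = 1

  bit-true : ∀ {b} → T b → bit b ≡ 1
  bit-true {true} _ = refl

  bit-false : ∀ {b} → (T b → ⊥) → bit b ≡ 0
  bit-false {true}  h = ⊥-elim (h tt)
  bit-false {false} _ = refl

  bit≤1 : ∀ b → bit b ≤ 1
  bit≤1 false = z≤n
  bit≤1 true  = ≤-refl

  bit-mono : ∀ {a b} → (T a → T b) → bit a ≤ bit b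
  bit-mono {false}         _ = z≤n
  bit-mono {true}  {true}  _ = ≤-refl
  bit-mono {true}  {false} h = ⊥-elim (h tt)

  bit-≤-+ : ∀ {a b c} → (T a → T b ⊎ T c) → bit a ≤ bit b + bit c
  bit-≤-+ {false}                 _ = z≤n
  bit-≤-+ {true}  {true}          _ = s≤s z≤n
  bit-≤-+ {true}  {false} {true}  _ = ≤-refl
  bit-≤-+ {true}  {false} {false} h with h tt
  ... | inj₁ ()
  ... | inj₂ ()

  bit-+-≤ : ∀ {a b c} → (T a → T c) → (T b → T c) → (T a → T b → ⊥) → bit a + bit b ≤ bit c
  bit-+-≤ {false} {false}         _  _  _ = z≤n
  bit-+-≤ {true}  {false} {true}  _  _  _ = ≤-refl
  bit-+-≤ {false} {true}  {true}  _  _  _ = ≤-refl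
  bit-+-≤ {true}  {false} {false} ha _  _ = ⊥-elim (ha tt)
  bit-+-≤ {false} {true}  {false} _  hb _ = ⊥-elim (hb tt)
  bit-+-≤ {true}  {true}          _  _  d = ⊥-elim (d tt tt)

  module _ {A : Set} where

    countB-∷ : ∀ (p : A → Bool) x xs → countB p (x ∷ xs) ≡ bit (p x) + countB p xs
    countB-∷ p x xs with p x
    ... | true  = refl
    ... | false = refl

    countB-∷ʳ : ∀ (p : A → Bool) xs x → countB p (xs ∷ʳ x) ≡ countB p xs + bit (p x)
    countB-∷ʳ p []       x = trans (countB-∷ p x []) (+-comm (bit (p x)) 0)
    countB-∷ʳ p (y ∷ xs) x = begin
      countB p (y ∷ (xs ∷ʳ x))               ≡⟨ countB-∷ p y (xs ∷ʳ x) ⟩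
      bit (p y) + countB p (xs ∷ʳ x)         ≡⟨ cong (bit (p y) +_) (countB-∷ʳ p xs x) ⟩
      bit (p y) + (countB p xs + bit (p x))  ≡⟨ +-assoc (bit (p y)) _ _ ⟨
      bit (p y) + countB p xs + bit (p x)    ≡⟨ cong (_+ bit (p x)) (countB-∷ p y xs) ⟨
      countB p (y ∷ xs) + bit (p x)          ∎
      where open ≡-Reasoning

    countB-map : ∀ {B : Set} (p : B → Bool) (f : A → B) xs → countB p (map f xs) ≡ countB (p ∘ f) xs
    countB-map p f []       = refl
    countB-map p f (x ∷ xs) with p (f x)
    ... | true  = cong suc (countB-map p f xs)
    ... | false = countB-map p f xs

    countB-mono : ∀ {p q : A → Bool} → (∀ x → T (p x) → T (q x)) → ∀ xs → countB p xs ≤ countB q xs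
    countB-mono             h []       = z≤n
    countB-mono {p} {q} h (x ∷ xs) = begin
      countB p (x ∷ xs)         ≡⟨ countB-∷ p x xs ⟩
      bit (p x) + countB p xs   ≤⟨ +-mono-≤ (bit-mono (h x)) (countB-mono h xs) ⟩
      bit (q x) + countB q xs   ≡⟨ countB-∷ q x xs ⟨
      countB q (x ∷ xs)         ∎
      where open ≤-Reasoning

    countB-≤-+ : ∀ {p q r : A → Bool} → (∀ x → T (p x) → T (q x) ⊎ T (r x)) →
                 ∀ xs → countB p xs ≤ countB q xs + countB r xs
    countB-≤-+             h []       = z≤n
    countB-≤-+ {p} {q} {r} h (x ∷ xs) = begin
      countB p (x ∷ xs)                                     ≡⟨ countB-∷ p x xs ⟩
      bit (p x) + countB p xs                               ≤⟨ +-mono-≤ (bit-≤-+ (h x)) (countB-≤-+ h xs) ⟩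
      (bit (q x) + bit (r x)) + (countB q xs + countB r xs) ≡⟨ interchange (bit (q x)) (bit (r x)) (countB q xs) (countB r xs) ⟩
      (bit (q x) + countB q xs) + (bit (r x) + countB r xs) ≡⟨ cong₂ _+_ (countB-∷ q x xs) (countB-∷ r x xs) ⟨
      countB q (x ∷ xs) + countB r (x ∷ xs)                 ∎
      where open ≤-Reasoning

    countB-+-≤ : ∀ {p q r : A → Bool} → (∀ x → T (p x) → T (r x)) → (∀ x → T (q x) → T (r x)) →
                 (∀ x → T (p x) → T (q x) → ⊥) → ∀ xs → countB p xs + countB q xs ≤ countB r xs
    countB-+-≤             hp hq d []       = z≤n
    countB-+-≤ {p} {q} {r} hp hq d (x ∷ xs) = begin
      countB p (x ∷ xs) + countB q (x ∷ xs)                 ≡⟨ cong₂ _+_ (countB-∷ p x xs) (countB-∷ q x xs) ⟩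
      (bit (p x) + countB p xs) + (bit (q x) + countB q xs) ≡⟨ interchange (bit (p x)) (countB p xs) (bit (q x)) (countB q xs) ⟩
      (bit (p x) + bit (q x)) + (countB p xs + countB q xs) ≤⟨ +-mono-≤ (bit-+-≤ (hp x) (hq x) (d x)) (countB-+-≤ hp hq d xs) ⟩
      bit (r x) + countB r xs                               ≡⟨ countB-∷ r x xs ⟨
      countB r (x ∷ xs)                                     ∎
      where open ≤-Reasoning

  fromℕ : ℕ → ℚ
  fromℕ n = ℤ.+ n / 1

  private
    ⟦_⟧ᵘ : ℕ → ℚᵘ.ℚᵘ
    ⟦ m ⟧ᵘ = ℚᵘ.mkℚᵘ (ℤ.+ m) 0

    toℚᵘ-fromℕ : ∀ m → toℚᵘ (fromℕ m) ℚᵘ.≃ ⟦ m ⟧ᵘ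
    toℚᵘ-fromℕ m = ℚ.toℚᵘ-fromℚᵘ ⟦ m ⟧ᵘ

    ⟦+⟧ᵘ : ∀ m n → ⟦ m + n ⟧ᵘ ℚᵘ.≃ ⟦ m ⟧ᵘ ℚᵘ.+ ⟦ n ⟧ᵘ
    ⟦+⟧ᵘ m n = ℚᵘ.*≡* (cong (ℤ._* ℤ.+ 1)
      (trans (ℤ.pos-+ m n) (sym (cong₂ ℤ._+_ (ℤ.*-identityʳ (ℤ.+ m)) (ℤ.*-identityʳ (ℤ.+ n))))))

    ⟦*⟧ᵘ : ∀ m n → ⟦ m * n ⟧ᵘ ℚᵘ.≃ ⟦ m ⟧ᵘ ℚᵘ.* ⟦ n ⟧ᵘ
    ⟦*⟧ᵘ m n = ℚᵘ.*≡* (cong (ℤ._* ℤ.+ 1) (ℤ.pos-* m n))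

  fromℕ-+ : ∀ m n → fromℕ (m + n) ≡ fromℕ m ℚ.+ fromℕ n
  fromℕ-+ m n = ℚ.toℚᵘ-injective (begin
    toℚᵘ (fromℕ (m + n))                ≈⟨ toℚᵘ-fromℕ (m + n) ⟩
    ⟦ m + n ⟧ᵘ                          ≈⟨ ⟦+⟧ᵘ m n ⟩
    ⟦ m ⟧ᵘ ℚᵘ.+ ⟦ n ⟧ᵘ                   ≈⟨ ℚᵘ.+-cong (toℚᵘ-fromℕ m) (toℚᵘ-fromℕ n) ⟨
    toℚᵘ (fromℕ m) ℚᵘ.+ toℚᵘ (fromℕ n)  ≈⟨ ℚ.toℚᵘ-homo-+ (fromℕ m) (fromℕ n) ⟨
    toℚᵘ (fromℕ m ℚ.+ fromℕ n)          ∎)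
    where open ℚᵘ.≃-Reasoning

  fromℕ-* : ∀ m n → fromℕ (m * n) ≡ fromℕ m ℚ.* fromℕ n
  fromℕ-* m n = ℚ.toℚᵘ-injective (begin
    toℚᵘ (fromℕ (m * n))                ≈⟨ toℚᵘ-fromℕ (m * n) ⟩
    ⟦ m * n ⟧ᵘ                          ≈⟨ ⟦*⟧ᵘ m n ⟩
    ⟦ m ⟧ᵘ ℚᵘ.* ⟦ n ⟧ᵘ                   ≈⟨ ℚᵘ.*-cong (toℚᵘ-fromℕ m) (toℚᵘ-fromℕ n) ⟨
    toℚᵘ (fromℕ m) ℚᵘ.* toℚᵘ (fromℕ n)  ≈⟨ ℚ.toℚᵘ-homo-* (fromℕ m) (fromℕ n) ⟨
    toℚᵘ (fromℕ m ℚ.* fromℕ n)          ∎)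
    where open ℚᵘ.≃-Reasoning

  fromℕ-mono-≤ : ∀ {m n} → m ≤ n → fromℕ m ℚ.≤ fromℕ n
  fromℕ-mono-≤ {m} {n} m≤n = ℚ.toℚᵘ-cancel-≤ (begin
    toℚᵘ (fromℕ m)  ≃⟨ toℚᵘ-fromℕ m ⟩
    ⟦ m ⟧ᵘ          ≤⟨ ℚᵘ.*≤* (subst₂ ℤ._≤_ (sym (ℤ.*-identityʳ (ℤ.+ m))) (sym (ℤ.*-identityʳ (ℤ.+ n))) (ℤ.+≤+ m≤n)) ⟩
    ⟦ n ⟧ᵘ          ≃⟨ toℚᵘ-fromℕ n ⟨
    toℚᵘ (fromℕ n)  ∎)
    where open ℚᵘ.≤-Reasoning

  frac-*-denominator : ∀ a d → frac a (suc d) ℚ.* fromℕ (suc d) ≡ fromℕ a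
  frac-*-denominator a d = ℚ.toℚᵘ-injective (begin
    toℚᵘ (frac a (suc d) ℚ.* fromℕ (suc d))
      ≈⟨ ℚ.toℚᵘ-homo-* (frac a (suc d)) (fromℕ (suc d)) ⟩
    toℚᵘ (frac a (suc d)) ℚᵘ.* toℚᵘ (fromℕ (suc d))
      ≈⟨ ℚᵘ.*-cong (ℚ.toℚᵘ-fromℚᵘ (ℚᵘ.mkℚᵘ (ℤ.+ a) d)) (toℚᵘ-fromℕ (suc d)) ⟩
    ℚᵘ.mkℚᵘ (ℤ.+ a) d ℚᵘ.* ⟦ suc d ⟧ᵘ
      ≈⟨ ℚᵘ.*≡* (trans (ℤ.*-identityʳ _) (cong (λ x → ℤ.+ a ℤ.* ℤ.+ x) (sym (*-identityʳ (suc d))))) ⟩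
    ⟦ a ⟧ᵘ
      ≈⟨ toℚᵘ-fromℕ a ⟨
    toℚᵘ (fromℕ a)
      ∎)
    where open ℚᵘ.≃-Reasoning

  frac-bound : ∀ {b c G} D → b ≤ c → b * D + c * G ≤ c * D → fromℕ b ℚ.+ fromℕ c ℚ.* frac G D ℚ.≤ fromℕ c
  -- frac G 0 = 0ℚ, so for D = 0 the bound only needs b ≤ c.
  frac-bound {b} {c} zero b≤c _ = begin
    fromℕ b ℚ.+ fromℕ c ℚ.* 0ℚ  ≡⟨ cong (fromℕ b ℚ.+_) (ℚ.*-zeroʳ (fromℕ c)) ⟩
    fromℕ b ℚ.+ 0ℚ              ≡⟨ ℚ.+-identityʳ (fromℕ b) ⟩
    fromℕ b                     ≤⟨ fromℕ-mono-≤ b≤c ⟩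
    fromℕ c                     ∎
    where open ℚ.≤-Reasoning
  frac-bound {b} {c} {G} (suc d) _ bound = ℚ.*-cancelʳ-≤-pos D {{ℚ.normalize-pos (suc d) 1}} (begin
    (fromℕ b ℚ.+ fromℕ c ℚ.* Y) ℚ.* D
      ≡⟨ solve 4 (λ x y z w → (x :+ y :* z) :* w := x :* w :+ y :* (z :* w)) refl (fromℕ b) (fromℕ c) Y D ⟩
    fromℕ b ℚ.* D ℚ.+ fromℕ c ℚ.* (Y ℚ.* D)
      ≡⟨ cong (λ z → fromℕ b ℚ.* D ℚ.+ fromℕ c ℚ.* z) (frac-*-denominator G d) ⟩
    fromℕ b ℚ.* D ℚ.+ fromℕ c ℚ.* fromℕ G
      ≡⟨ trans (fromℕ-+ (b * suc d) (c * G)) (cong₂ ℚ._+_ (fromℕ-* b (suc d)) (fromℕ-* c G)) ⟨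
    fromℕ (b * suc d + c * G)
      ≤⟨ fromℕ-mono-≤ bound ⟩
    fromℕ (c * suc d)
      ≡⟨ fromℕ-* c (suc d) ⟩
    fromℕ c ℚ.* D
      ∎)
    where
    open ℚ.≤-Reasoning
    open ℚ.+-*-Solver
    D = fromℕ (suc d)
    Y = frac G (suc d)

  sum-bound : ∀ {A : Set} (p : A → Bool) (Y : A → ℚ) (r : ℚ) xs →
              (∀ {x} → x ∈ xs → fromℕ (bit (p x)) ℚ.+ r ℚ.* Y x ℚ.≤ r) →
              fromℕ (countB p xs) ℚ.+ r ℚ.* sumℚ Y xs ℚ.≤ r ℚ.* fromℕ (length xs)
  sum-bound p Y r []       _ = ℚ.≤-reflexive (ℚ.+-identityˡ (r ℚ.* 0ℚ))
  sum-bound p Y r (x ∷ xs) h = begin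
    fromℕ (countB p (x ∷ xs)) ℚ.+ r ℚ.* (Y x ℚ.+ sumℚ Y xs)
      ≡⟨ cong (λ z → fromℕ z ℚ.+ r ℚ.* (Y x ℚ.+ sumℚ Y xs)) (countB-∷ p x xs) ⟩
    fromℕ (bit (p x) + countB p xs) ℚ.+ r ℚ.* (Y x ℚ.+ sumℚ Y xs)
      ≡⟨ cong (ℚ._+ r ℚ.* (Y x ℚ.+ sumℚ Y xs)) (fromℕ-+ (bit (p x)) (countB p xs)) ⟩
    fromℕ (bit (p x)) ℚ.+ fromℕ (countB p xs) ℚ.+ r ℚ.* (Y x ℚ.+ sumℚ Y xs)
      ≡⟨ solve 5 (λ a b c d e → (a :+ b) :+ c :* (d :+ e) := (a :+ c :* d) :+ (b :+ c :* e)) refl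
                 (fromℕ (bit (p x))) (fromℕ (countB p xs)) r (Y x) (sumℚ Y xs) ⟩
    (fromℕ (bit (p x)) ℚ.+ r ℚ.* Y x) ℚ.+ (fromℕ (countB p xs) ℚ.+ r ℚ.* sumℚ Y xs)
      ≤⟨ ℚ.+-mono-≤ (h (here refl)) (sum-bound p Y r xs (h ∘ there)) ⟩
    r ℚ.+ r ℚ.* fromℕ (length xs)
      ≡⟨ solve 2 (λ c m → c :+ c :* m := c :* (con 1ℚ :+ m)) refl r (fromℕ (length xs)) ⟩
    r ℚ.* (1ℚ ℚ.+ fromℕ (length xs))
      ≡⟨ cong (r ℚ.*_) (fromℕ-+ 1 (length xs)) ⟨
    r ℚ.* fromℕ (length (x ∷ xs))
      ∎
    where
    open ℚ.≤-Reasoning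
    open ℚ.+-*-Solver

  average-bound : ∀ {B c ε X} L → 0ℚ ℚ.≤ ε → frac 1 L ℚ.* X ≡ 1ℚ ℚ.- ε →
                  fromℕ B ℚ.+ fromℕ c ℚ.* X ℚ.≤ fromℕ c ℚ.* fromℕ L → frac B L ℚ.≤ fromℕ c ℚ.* ε
  -- For an empty family frac B 0 = 0ℚ; this is the only place where 0 ≤ ε is needed.
  average-bound {c = c} {ε} zero ε≥0 _ _ = begin
    0ℚ              ≡⟨ ℚ.*-zeroʳ (fromℕ c) ⟨
    fromℕ c ℚ.* 0ℚ  ≤⟨ ℚ.*-monoˡ-≤-nonNeg (fromℕ c) {{ℚ.nonNegative (fromℕ-mono-≤ {0} {c} z≤n)}} ε≥0 ⟩
    fromℕ c ℚ.* ε   ∎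
    where open ℚ.≤-Reasoning
  average-bound {B} {c} {ε} {X} (suc l) _ accept bound = ℚ.*-cancelʳ-≤-pos L {{ℚ.normalize-pos (suc l) 1}} (begin
    frac B (suc l) ℚ.* L
      ≡⟨ frac-*-denominator B l ⟩
    fromℕ B
      ≡⟨ solve 2 (λ b y → b := b :+ y :- y) refl (fromℕ B) cX ⟩
    fromℕ B ℚ.+ cX ℚ.- cX
      ≤⟨ ℚ.+-monoˡ-≤ (ℚ.- cX) bound ⟩
    fromℕ c ℚ.* L ℚ.- cX
      ≡⟨ cong (λ z → fromℕ c ℚ.* L ℚ.- z) (ℚ.*-identityʳ cX) ⟨
    fromℕ c ℚ.* L ℚ.- cX ℚ.* 1ℚ
      ≡⟨ cong (λ z → fromℕ c ℚ.* L ℚ.- cX ℚ.* z) (frac-*-denominator 1 l) ⟨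
    fromℕ c ℚ.* L ℚ.- cX ℚ.* (P ℚ.* L)
      ≡⟨ solve 4 (λ f m x p → f :* m :- f :* x :* (p :* m) := f :* (con 1ℚ :- p :* x) :* m) refl (fromℕ c) L X P ⟩
    fromℕ c ℚ.* (1ℚ ℚ.- P ℚ.* X) ℚ.* L
      ≡⟨ cong (λ z → fromℕ c ℚ.* (1ℚ ℚ.- z) ℚ.* L) accept ⟩
    fromℕ c ℚ.* (1ℚ ℚ.- (1ℚ ℚ.- ε)) ℚ.* L
      ≡⟨ solve 3 (λ f e m → f :* (con 1ℚ :- (con 1ℚ :- e)) :* m := f :* e :* m) refl (fromℕ c) ε L ⟩
    fromℕ c ℚ.* ε ℚ.* L
      ∎)
    where
    open ℚ.≤-Reasoning
    open ℚ.+-*-Solver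
    L = fromℕ (suc l)
    P = frac 1 (suc l)
    cX = fromℕ c ℚ.* X

  -- The bound for an arbitrary family of sets

  ==⇒≡ : ∀ {x y} → T (x == y) → x ≡ y
  ==⇒≡ {true}  {true}  _ = refl
  ==⇒≡ {false} {false} _ = refl

  ≡⇒== : ∀ {x y} → x ≡ y → T (x == y)
  ≡⇒== {true}  refl = tt
  ≡⇒== {false} refl = tt

  ∧-cases : ∀ {b} c → T b → T (b ∧ not c) ⊎ T (b ∧ c)
  ∧-cases {true} false _ = inj₁ tt
  ∧-cases {true} true  _ = inj₂ tt

  module _ {n : ℕ} where

    ∈ᵇ-∩ : ∀ (S S' : Subset n) j → T (j ∈ᵇ (S ∩ S')) ⇔ (T (j ∈ᵇ S) × T (j ∈ᵇ S'))
    ∈ᵇ-∩ S S' j = subst (λ b → T b ⇔ (T (j ∈ᵇ S) × T (j ∈ᵇ S'))) (sym (lookup-zipWith _∧_ j S S')) T-∧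

    meets⁺ : ∀ {S S' : Subset n} {j} → T (j ∈ᵇ S) → T (j ∈ᵇ S') → T (meets S S')
    meets⁺ {S} {S'} {j} j∈S j∈S' = any⁺ _ (lose (∈-allFin j) (Equivalence.from (∈ᵇ-∩ S S' j) (j∈S , j∈S')))

    meets⁻ : ∀ {S S' : Subset n} → T (meets S S') → ∃ λ j → T (j ∈ᵇ S) × T (j ∈ᵇ S')
    meets⁻ {S} {S'} h with satisfied (any⁻ _ (allFin n) h)
    ... | j , j∈S∩S' = j , Equivalence.to (∈ᵇ-∩ S S' j) j∈S∩S'

    agreeOn⁻ : ∀ {U : Subset n} {f g j} → T (agreeOn U f g) → T (j ∈ᵇ U) → f j ≡ g j
    agreeOn⁻ {U} {f} {g} {j} h j∈U with Equivalence.to (T-∨ {not (j ∈ᵇ U)}) (All.lookup (all⁺ _ (allFin n) h) (∈-allFin j))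
    ... | inj₁ j∉U = ⊥-elim (subst T (Equivalence.to T-not-≡ j∉U) j∈U)
    ... | inj₂ fj=gj = ==⇒≡ fj=gj

    agreeOn-witness : ∀ {U : Subset n} {f g} → (T (agreeOn U f g) → ⊥) → ∃ λ j → T (j ∈ᵇ U) × (f j ≡ g j → ⊥)
    agreeOn-witness {U} {f} {g} h with satisfied (¬All⇒Any¬ (T? ∘ agreesAt) (allFin n) (h ∘ all⁻ agreesAt))
      where
      agreesAt : Fin n → Bool
      agreesAt j = not (j ∈ᵇ U) ∨ (f j == g j)
    ... | j , disagrees with j ∈ᵇ U in j∈U
    ...   | false = ⊥-elim (disagrees tt)
    ...   | true  = j , subst T (sym j∈U) tt , disagrees ∘ ≡⇒==

  rejection-arith : ∀ {c D C G opp sup} → D ≤ c * C → C ≤ opp + sup → opp ≤ sup → G + sup ≤ D →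
                    D + 2 * c * G ≤ 2 * c * D
  rejection-arith {c} {D} {C} {G} {opp} {sup} D≤cC C≤opp+sup opp≤sup G+sup≤D = begin
    D + 2 * c * G           ≤⟨ +-monoˡ-≤ (2 * c * G) D≤2csup ⟩
    2 * c * sup + 2 * c * G ≡⟨ *-distribˡ-+ (2 * c) sup G ⟨
    2 * c * (sup + G)       ≡⟨ cong (2 * c *_) (+-comm sup G) ⟩
    2 * c * (G + sup)       ≤⟨ *-monoʳ-≤ (2 * c) G+sup≤D ⟩
    2 * c * D               ∎
    where
    open ≤-Reasoning
    D≤2csup : D ≤ 2 * c * sup
    D≤2csup = begin
      D                 ≤⟨ D≤cC ⟩
      c * C             ≤⟨ *-monoʳ-≤ c (≤-trans C≤opp+sup (+-monoˡ-≤ sup opp≤sup)) ⟩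
      c * (sup + sup)   ≡⟨ solve 2 (λ c s → c :* (s :+ s) := con 2 :* c :* s) refl c sup ⟩
      2 * c * sup       ∎
      where open +-*-Solver

  module _ {n : ℕ} (V : List (Subset n)) where

    degree : Subset n → ℕ
    degree S = countB (meets S) V

    coverage : Fin n → ℕ
    coverage i = countB (i ∈ᵇ_) V

    DegreeBoundedBy : ℕ → Set
    DegreeBoundedBy c = ∀ {S} → S ∈ V → ∀ {i} → T (i ∈ᵇ S) → degree S ≤ c * coverage i

    module _ (F : Assignment n) (a : Fin n → Bool) where

      consistentDegree : Subset n → ℕ
      consistentDegree S = countB (λ S' → meets S S' ∧ agreeOn (S ∩ S') (F S) (F S')) V

      supporters opponents : Fin n → ℕ
      supporters i = countB (λ S' → (i ∈ᵇ S') ∧ (F S' i == a i)) V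
      opponents  i = countB (λ S' → (i ∈ᵇ S') ∧ not (F S' i == a i)) V

      consistentDegree≤degree : ∀ S → consistentDegree S ≤ degree S
      consistentDegree≤degree S = countB-mono (λ S' → proj₁ ∘ Equivalence.to (T-∧ {meets S S'})) V

      coverage≤opponents+supporters : ∀ i → coverage i ≤ opponents i + supporters i
      coverage≤opponents+supporters i = countB-≤-+ (λ S' → ∧-cases (F S' i == a i)) V

      consistentDegree+supporters≤degree : ∀ {S i} → T (i ∈ᵇ S) → (F S i ≡ a i → ⊥) →
                                           consistentDegree S + supporters i ≤ degree S
      consistentDegree+supporters≤degree {S} {i} i∈S FSi≢ai = countB-+-≤ consistent⇒meets supporter⇒meets disjoint V
        where
        consistent⇒meets : ∀ S' → T (meets S S' ∧ agreeOn (S ∩ S') (F S) (F S')) → T (meets S S')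
        consistent⇒meets S' = proj₁ ∘ Equivalence.to (T-∧ {meets S S'})
        supporter⇒meets : ∀ S' → T ((i ∈ᵇ S') ∧ (F S' i == a i)) → T (meets S S')
        supporter⇒meets S' = meets⁺ {S = S} {S'} i∈S ∘ proj₁ ∘ Equivalence.to (T-∧ {i ∈ᵇ S'})
        disjoint : ∀ S' → T (meets S S' ∧ agreeOn (S ∩ S') (F S) (F S')) → T ((i ∈ᵇ S') ∧ (F S' i == a i)) → ⊥
        disjoint S' consistent supports
          with Equivalence.to (T-∧ {meets S S'}) consistent | Equivalence.to (T-∧ {i ∈ᵇ S'}) supports
        ... | _ , agree | i∈S' , FS'i=ai = FSi≢ai (trans FSi=FS'i (==⇒≡ FS'i=ai))
          where
          FSi=FS'i : F S i ≡ F S' i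
          FSi=FS'i = agreeOn⁻ {U = S ∩ S'} {F S} {F S'} agree (Equivalence.from (∈ᵇ-∩ S S' i) (i∈S , i∈S'))

      rejected-set-bound : ∀ {c S} → DegreeBoundedBy c → IsMajority V F a → S ∈ V → (T (agreeOn S (F S) a) → ⊥) →
                       degree S + 2 * c * consistentDegree S ≤ 2 * c * degree S
      rejected-set-bound {c} {S} bounded majority S∈V rejected with agreeOn-witness {U = S} rejected
      ... | i , i∈S , FSi≢ai = rejection-arith {c} (bounded S∈V i∈S) (coverage≤opponents+supporters i) (majority i)
                                               (consistentDegree+supporters≤degree i∈S FSi≢ai)

      set-bound : ∀ {c S} → DegreeBoundedBy c → IsMajority V F a → S ∈ V →
                  bit (not (agreeOn S (F S) (DP a S))) * degree S + 2 * c * consistentDegree S ≤ 2 * c * degree S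
      set-bound {c} {S} bounded majority S∈V with agreeOn S (F S) a in agrees
      ... | true  = *-monoʳ-≤ (2 * c) (consistentDegree≤degree S)
      ... | false = subst (λ x → x + 2 * c * consistentDegree S ≤ 2 * c * degree S) (sym (+-identityʳ (degree S)))
                          (rejected-set-bound {c} bounded majority S∈V (subst T agrees))

      dist-majority-≤ : ∀ {c ε} → 1 ≤ c → DegreeBoundedBy c → IsMajority V F a → 0ℚ ℚ.≤ ε →
                        acceptProb V F ≡ 1ℚ ℚ.- ε → dist V F (DP a) ℚ.≤ fromℕ (2 * c) ℚ.* ε
      dist-majority-≤ {c} 1≤c bounded majority ε≥0 accept =
        average-bound {c = 2 * c} (length V) ε≥0 accept (sum-bound rejects consistentFraction (fromℕ (2 * c)) V per-set)
        where
        rejects : Subset n → Bool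
        rejects S = not (agreeOn S (F S) (DP a S))
        consistentFraction : Subset n → ℚ
        consistentFraction S = frac (consistentDegree S) (degree S)
        per-set : ∀ {S} → S ∈ V → fromℕ (bit (rejects S)) ℚ.+ fromℕ (2 * c) ℚ.* consistentFraction S ℚ.≤ fromℕ (2 * c)
        per-set {S} S∈V = frac-bound {c = 2 * c} (degree S) (≤-trans (bit≤1 (rejects S)) (≤-trans 1≤c (m≤n*m c 2)))
                                     (set-bound {c} bounded majority S∈V)

  -- Cyclic intervals

  inRange : ℕ → ℕ → ℕ → Bool
  inRange a b t = (a ≤ᵇ t) ∧ (t <ᵇ b)

  inRange⁺ : ∀ {a b t} → a ≤ t → t < b → T (inRange a b t)
  inRange⁺ a≤t t<b = Equivalence.from T-∧ (≤⇒≤ᵇ a≤t , <⇒<ᵇ t<b)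

  inRange⁻ : ∀ {a b t} → T (inRange a b t) → a ≤ t × t < b
  inRange⁻ {a} {b} {t} h with Equivalence.to (T-∧ {a ≤ᵇ t}) h
  ... | a≤ᵇt , t<ᵇb = ≤ᵇ⇒≤ a t a≤ᵇt , <ᵇ⇒< t b t<ᵇb

  countB-inRange-upTo : ∀ a b n → countB (inRange a b) (upTo n) ≡ (n ⊓ b) ∸ a
  countB-inRange-upTo a b zero    = sym (0∸n≡0 a)
  countB-inRange-upTo a b (suc n) = begin
    countB (inRange a b) (upTo (suc n))                ≡⟨ cong (countB (inRange a b)) (upTo-∷ʳ n) ⟨
    countB (inRange a b) (upTo n ∷ʳ n)                 ≡⟨ countB-∷ʳ (inRange a b) (upTo n) n ⟩
    countB (inRange a b) (upTo n) + bit (inRange a b n) ≡⟨ cong (_+ bit (inRange a b n)) (countB-inRange-upTo a b n) ⟩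
    (n ⊓ b) ∸ a + bit (inRange a b n)                  ≡⟨ step ⟩
    (suc n ⊓ b) ∸ a                                    ∎
    where
    open ≡-Reasoning
    step : (n ⊓ b) ∸ a + bit (inRange a b n) ≡ (suc n ⊓ b) ∸ a
    step with n <? b | a ≤? n
    ... | no n≮b | _ rewrite m≥n⇒m⊓n≡n (≮⇒≥ n≮b) | m≥n⇒m⊓n≡n (m≤n⇒m≤1+n (≮⇒≥ n≮b))
      = trans (cong ((b ∸ a) +_) (bit-false (n≮b ∘ proj₂ ∘ inRange⁻ {a} {b}))) (+-identityʳ (b ∸ a))
    ... | yes n<b | yes a≤n rewrite m≤n⇒m⊓n≡m (<⇒≤ n<b) | m≤n⇒m⊓n≡m n<b | bit-true (inRange⁺ a≤n n<b)
      = trans (+-comm (n ∸ a) 1) (sym (+-∸-assoc 1 a≤n))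
    ... | yes n<b | no a≰n rewrite m≤n⇒m⊓n≡m (<⇒≤ n<b) | m≤n⇒m⊓n≡m n<b
        | m≤n⇒m∸n≡0 (<⇒≤ (≰⇒> a≰n)) | m≤n⇒m∸n≡0 (≰⇒> a≰n) = bit-false (a≰n ∘ proj₁ ∘ inRange⁻ {a} {b})

  tabulate-∘toℕ : ∀ {A : Set} (f : ℕ → A) n → tabulate {n = n} (f ∘ toℕ) ≡ applyUpTo f n
  tabulate-∘toℕ f zero    = refl
  tabulate-∘toℕ f (suc n) = cong (f 0 ∷_) (tabulate-∘toℕ (f ∘ suc) n)

  countB-allFin : ∀ (q : ℕ → Bool) n → countB (q ∘ toℕ) (allFin n) ≡ countB q (upTo n)
  countB-allFin q n = begin
    countB (q ∘ toℕ) (allFin n)   ≡⟨ countB-map q toℕ (allFin n) ⟨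
    countB q (map toℕ (allFin n)) ≡⟨ cong (countB q) (trans (map-tabulate id toℕ) (tabulate-∘toℕ id n)) ⟩
    countB q (upTo n)             ∎
    where open ≡-Reasoning

  countB-inRange-allFin : ∀ a b n → countB (inRange a b ∘ toℕ) (allFin n) ≡ (n ⊓ b) ∸ a
  countB-inRange-allFin a b n = trans (countB-allFin (inRange a b) n) (countB-inRange-upTo a b n)

  countB-inRange-allFin-≤ : ∀ a {b n} → b ≤ n → countB (inRange a b ∘ toℕ) (allFin n) ≡ b ∸ a
  countB-inRange-allFin-≤ a {b} {n} b≤n = trans (countB-inRange-allFin a b n) (cong (_∸ a) (m≥n⇒m⊓n≡n b≤n))

  InArc : ℕ → ℕ → ℕ → ℕ → Set
  InArc n k s j = (s ≤ j × j < s + k) ⊎ (j + n < s + k)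

  ≤+⇒∸≤ : ∀ {x t k} → x ≤ t + k → x ∸ k ≤ t
  ≤+⇒∸≤ {x} {t} {k} h = m≤n+o⇒m∸n≤o x k (subst (x ≤_) (+-comm t k) h)

  ∸≤⇒≤+ : ∀ {x t k} → x ∸ k ≤ t → x ≤ t + k
  ∸≤⇒≤+ {x} {t} {k} h = ≤-trans (m≤n+m∸n x k) (subst (k + (x ∸ k) ≤_) (+-comm k t) (+-monoʳ-≤ k h))

  module _ {n k : ℕ} where

    InArc-self : ∀ {s} → 1 ≤ k → InArc n k s s
    InArc-self {s} 1≤k = inj₁ (≤-refl , m<m+n s 1≤k)

    InArc-meet : ∀ {s t j} → s < n → t < n → InArc n k s j → InArc n k t j → InArc n k t s ⊎ InArc n k s t
    InArc-meet {s} {t} _ _ (inj₁ (s≤j , j<s+k)) (inj₁ (t≤j , j<t+k)) with ≤-total t s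
    ... | inj₁ t≤s = inj₁ (inj₁ (t≤s , ≤-<-trans s≤j j<t+k))
    ... | inj₂ s≤t = inj₂ (inj₁ (s≤t , ≤-<-trans t≤j j<s+k))
    InArc-meet _ _ (inj₁ (s≤j , _)) (inj₂ j+n<t+k) = inj₁ (inj₂ (≤-<-trans (+-monoˡ-≤ n s≤j) j+n<t+k))
    InArc-meet _ _ (inj₂ j+n<s+k) (inj₁ (t≤j , _)) = inj₂ (inj₂ (≤-<-trans (+-monoˡ-≤ n t≤j) j+n<s+k))
    InArc-meet {s} {t} {j} s<n t<n (inj₂ j+n<s+k) (inj₂ j+n<t+k) with ≤-total s t
    ... | inj₁ s≤t = inj₂ (inj₁ (s≤t , <-trans (<-≤-trans t<n (m≤n+m n j)) j+n<s+k))
    ... | inj₂ t≤s = inj₁ (inj₁ (t≤s , <-trans (<-≤-trans s<n (m≤n+m n j)) j+n<t+k))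

    InArc⁻-start : ∀ {t i} → t < n → InArc n k t i →
                   T (inRange (suc i ∸ k) (suc i) t) ⊎ T (inRange (suc i + n ∸ k) n t)
    InArc⁻-start t<n (inj₁ (t≤i , i<t+k)) = inj₁ (inRange⁺ (≤+⇒∸≤ i<t+k) (s≤s t≤i))
    InArc⁻-start t<n (inj₂ i+n<t+k)       = inj₂ (inRange⁺ (≤+⇒∸≤ i+n<t+k) t<n)

    InArc⁺-start₁ : ∀ {t i} → T (inRange (suc i ∸ k) (suc i) t) → InArc n k t i
    InArc⁺-start₁ {t} {i} h with inRange⁻ {suc i ∸ k} {suc i} {t} h
    ... | lo , hi = inj₁ (s≤s⁻¹ hi , ∸≤⇒≤+ lo)

    InArc⁺-start₂ : ∀ {t i} → T (inRange (suc i + n ∸ k) n t) → InArc n k t i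
    InArc⁺-start₂ {t} {i} h = inj₂ (∸≤⇒≤+ (proj₁ (inRange⁻ {suc i + n ∸ k} {n} {t} h)))

    start-ranges-disjoint : ∀ {t i} → k ≤ n →
      T (inRange (suc i ∸ k) (suc i) t) → T (inRange (suc i + n ∸ k) n t) → ⊥
    start-ranges-disjoint {t} {i} k≤n h₁ h₂ =
      <⇒≱ (proj₂ (inRange⁻ {suc i ∸ k} {suc i} {t} h₁))
          (≤-trans (m+n≤o⇒m≤o∸n (suc i) (+-monoʳ-≤ (suc i) k≤n)) (proj₁ (inRange⁻ {suc i + n ∸ k} {n} h₂)))

    InArc⁻-member : ∀ {s j} → InArc n k s j → T (inRange s (s + k) j) ⊎ T (inRange 0 (s + k ∸ n) j)
    InArc⁻-member (inj₁ (s≤j , j<s+k)) = inj₁ (inRange⁺ s≤j j<s+k)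
    InArc⁻-member {s} {j} (inj₂ j+n<s+k) = inj₂ (inRange⁺ z≤n (m+n≤o⇒m≤o∸n (suc j) {n} {s + k} j+n<s+k))

  InArc-full : ∀ {n s j} → j < n → InArc n n s j
  InArc-full {n} {s} {j} j<n with ≤-total s j
  ... | inj₁ s≤j = inj₁ (s≤j , <-≤-trans j<n (m≤n+m n s))
  ... | inj₂ j≤s with m≤n⇒m<n∨m≡n j≤s
  ...   | inj₁ j<s  = inj₂ (+-monoˡ-< n j<s)
  ...   | inj₂ refl = inj₁ (≤-refl , <-≤-trans j<n (m≤n+m n s))

  -- The separating point is the cyclic predecessor of s.
  InArc-separates : ∀ {n k s t} → k < n → s < t → t < n → InArc n k t s →
                    ∃ λ j → j < n × InArc n k t j × (InArc n k s j → ⊥)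
  InArc-separates         _   s<t _   (inj₁ (t≤s , _)) = ⊥-elim (<⇒≱ s<t t≤s)
  InArc-separates {suc n′} {k} {zero} {t} k<n _ t<n (inj₂ n<t+k) = n′ , ≤-refl , inj₁ (s≤s⁻¹ t<n , <⇒≤ n<t+k) , outside
    where
    outside : InArc (suc n′) k 0 n′ → ⊥
    outside (inj₁ (_ , n′<k)) = <⇒≱ k<n n′<k
    outside (inj₂ n′+n<k)    = <⇒≱ k<n (≤-trans (m≤n+m (suc n′) n′) (<⇒≤ n′+n<k))
  InArc-separates {n} {k} {suc s} {t} k<n s<t t<n (inj₂ s+n<t+k) =
    s , <-trans (<-trans (n<1+n s) s<t) t<n , inj₂ (<-trans (+-monoˡ-< n (n<1+n s)) s+n<t+k) , outside
    where
    outside : InArc n k (suc s) s → ⊥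
    outside (inj₁ (s<s , _)) = <-irrefl refl s<s
    outside (inj₂ s+n<s+k)   = <⇒≱ k<n (+-cancelˡ-≤ s n k (s≤s⁻¹ s+n<s+k))

  start-count : ∀ m {n k} → k ≤ n → m ∸ (m ∸ k) + (n ∸ (m + n ∸ k)) ≡ k
  start-count m {n} {k} k≤n with k ≤? m
  ... | yes k≤m = trans (cong₂ _+_ (m∸[m∸n]≡n k≤m) (m≤n⇒m∸n≡0 n≤m+n∸k)) (+-identityʳ k)
    where
    n≤m+n∸k : n ≤ m + n ∸ k
    n≤m+n∸k = m+n≤o⇒m≤o∸n n (subst (_≤ m + n) (+-comm k n) (+-monoˡ-≤ n k≤m))
  ... | no k≰m = begin
    m ∸ (m ∸ k) + (n ∸ (m + n ∸ k))     ≡⟨ cong (λ x → m ∸ x + (n ∸ (m + n ∸ k))) (m≤n⇒m∸n≡0 m≤k) ⟩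
    m + (n ∸ (m + n ∸ k))               ≡⟨ cong (λ x → m + (n ∸ (m + n ∸ x))) (m+[n∸m]≡n m≤k) ⟨
    m + (n ∸ (m + n ∸ (m + (k ∸ m))))   ≡⟨ cong (λ x → m + (n ∸ x)) ([m+n]∸[m+o]≡n∸o m n (k ∸ m)) ⟩
    m + (n ∸ (n ∸ (k ∸ m)))             ≡⟨ cong (m +_) (m∸[m∸n]≡n (≤-trans (m∸n≤m k m) k≤n)) ⟩
    m + (k ∸ m)                         ≡⟨ m+[n∸m]≡n m≤k ⟩
    k                                   ∎
    where
    open ≡-Reasoning
    m≤k : m ≤ k
    m≤k = <⇒≤ (≰⇒> k≰m)

  member-count : ∀ {n s k} → s ≤ n → (n ⊓ (s + k)) ∸ s + n ⊓ (s + k ∸ n) ≤ k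
  member-count {n} {s} {k} s≤n = begin
    (n ⊓ (s + k)) ∸ s + n ⊓ (s + k ∸ n)     ≤⟨ +-monoʳ-≤ ((n ⊓ (s + k)) ∸ s) (m⊓n≤n n (s + k ∸ n)) ⟩
    (n ⊓ (s + k)) ∸ s + (s + k ∸ n)         ≡⟨ +-∸-comm (s + k ∸ n) (⊓-glb s≤n (m≤m+n s k)) ⟨
    (n ⊓ (s + k) + (s + k ∸ n)) ∸ s         ≡⟨ cong (_∸ s) (m⊓n+n∸m≡n n (s + k)) ⟩
    s + k ∸ s                               ≡⟨ m+n∸m≡n s k ⟩
    k                                       ∎
    where open ≤-Reasoning

  module _ {n} (k : ℕ) (s j : Fin n) where

    private
      lookup-interval : lookup (interval n k s) j ≡
        ((toℕ s ≤ᵇ toℕ j) ∧ (toℕ j <ᵇ toℕ s + k)) ∨ (toℕ j + n <ᵇ toℕ s + k)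
      lookup-interval = lookup∘tabulate _ j

    ∈-interval⁺ : InArc n k (toℕ s) (toℕ j) → T (j ∈ᵇ interval n k s)
    ∈-interval⁺ h = subst T (sym lookup-interval) (Equivalence.from T-∨ (Sum.map from₁ <⇒<ᵇ h))
      where
      from₁ : toℕ s ≤ toℕ j × toℕ j < toℕ s + k → T (inRange (toℕ s) (toℕ s + k) (toℕ j))
      from₁ (s≤j , j<s+k) = inRange⁺ s≤j j<s+k

    ∈-interval⁻ : T (j ∈ᵇ interval n k s) → InArc n k (toℕ s) (toℕ j)
    ∈-interval⁻ h = Sum.map (inRange⁻ {toℕ s} {toℕ s + k}) (<ᵇ⇒< _ _)
                      (Equivalence.to (T-∨ {inRange (toℕ s) (toℕ s + k) (toℕ j)}) (subst T lookup-interval h))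

  module _ {n k : ℕ} where

    private
      I : Fin n → Subset n
      I = interval n k

    count-interval-containing : k ≤ n → ∀ i → countB (λ t → i ∈ᵇ I t) (allFin n) ≡ k
    count-interval-containing k≤n i = ≤-antisym
      (begin
        countB (λ t → i ∈ᵇ I t) (allFin n)       ≤⟨ countB-≤-+ in-ranges (allFin n) ⟩
        count first + count second               ≡⟨ ranges≡k ⟩
        k                                        ∎)
      (begin
        k                                        ≡⟨ ranges≡k ⟨
        count first + count second               ≤⟨ countB-+-≤ from-first from-second disjoint (allFin n) ⟩
        countB (λ t → i ∈ᵇ I t) (allFin n)       ∎)
      where
      open ≤-Reasoning
      m = suc (toℕ i)
      count : (ℕ → Bool) → ℕ
      count q = countB (q ∘ toℕ) (allFin n)
      first second : ℕ → Bool
      first  = inRange (m ∸ k) m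
      second = inRange (m + n ∸ k) n
      in-ranges : ∀ t → T (i ∈ᵇ I t) → T (first (toℕ t)) ⊎ T (second (toℕ t))
      in-ranges t = InArc⁻-start (toℕ<n t) ∘ ∈-interval⁻ k t i
      from-first : ∀ t → T (first (toℕ t)) → T (i ∈ᵇ I t)
      from-first t = ∈-interval⁺ k t i ∘ InArc⁺-start₁
      from-second : ∀ t → T (second (toℕ t)) → T (i ∈ᵇ I t)
      from-second t = ∈-interval⁺ k t i ∘ InArc⁺-start₂
      disjoint : ∀ t → T (first (toℕ t)) → T (second (toℕ t)) → ⊥
      disjoint t = start-ranges-disjoint {n} {k} {toℕ t} k≤n
      ranges≡k : count first + count second ≡ k
      ranges≡k = trans (cong₂ _+_ (countB-inRange-allFin-≤ (m ∸ k) (toℕ<n i)) (countB-inRange-allFin-≤ (m + n ∸ k) ≤-refl))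
                       (start-count m k≤n)

    count-interval-members : ∀ s → countB (_∈ᵇ I s) (allFin n) ≤ k
    count-interval-members s = begin
      countB (_∈ᵇ I s) (allFin n)
        ≤⟨ countB-≤-+ in-ranges (allFin n) ⟩
      countB (first ∘ toℕ) (allFin n) + countB (second ∘ toℕ) (allFin n)
        ≡⟨ cong₂ _+_ (countB-inRange-allFin s′ (s′ + k) n) (countB-inRange-allFin 0 (s′ + k ∸ n) n) ⟩
      (n ⊓ (s′ + k)) ∸ s′ + n ⊓ (s′ + k ∸ n)
        ≤⟨ member-count (<⇒≤ (toℕ<n s)) ⟩
      k ∎
      where
      open ≤-Reasoning
      s′ = toℕ s
      first second : ℕ → Bool
      first  = inRange s′ (s′ + k)
      second = inRange 0 (s′ + k ∸ n)
      in-ranges : ∀ j → T (j ∈ᵇ I s) → T (first (toℕ j)) ⊎ T (second (toℕ j))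
      in-ranges j = InArc⁻-member ∘ ∈-interval⁻ k s j

    meets-interval : ∀ s t → T (meets (I s) (I t)) → T (s ∈ᵇ I t) ⊎ T (t ∈ᵇ I s)
    meets-interval s t h with meets⁻ {S = I s} {S' = I t} h
    ... | j , j∈s , j∈t = Sum.map (∈-interval⁺ k t s) (∈-interval⁺ k s t)
                            (InArc-meet (toℕ<n s) (toℕ<n t) (∈-interval⁻ k s j j∈s) (∈-interval⁻ k t j j∈t))

    intervals-distinct : 1 ≤ k → k < n → ∀ {s t} → toℕ s < toℕ t → I s ≡ I t → ⊥
    intervals-distinct 1≤k k<n {s} {t} s<t Is≡It
      with InArc-separates k<n s<t (toℕ<n t) (∈-interval⁻ k t s (subst (λ S → T (s ∈ᵇ S)) Is≡It s∈Is))
      where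
      s∈Is : T (s ∈ᵇ I s)
      s∈Is = ∈-interval⁺ k s s (InArc-self 1≤k)
    ... | j , j<n , j∈It , j∉Is = j∉Is (subst (InArc n k (toℕ s)) (toℕ-fromℕ< j<n) (∈-interval⁻ k s j′ j′∈Is))
      where
      j′ : Fin n
      j′ = fromℕ< j<n
      j′∈Is : T (j′ ∈ᵇ I s)
      j′∈Is = subst (λ S → T (j′ ∈ᵇ S)) (sym Is≡It)
                (∈-interval⁺ k t j′ (subst (InArc n k (toℕ t)) (sym (toℕ-fromℕ< j<n)) j∈It))

    interval-injective : 1 ≤ k → k < n → ∀ {s t} → I s ≡ I t → s ≡ t
    interval-injective 1≤k k<n {s} {t} Is≡It with Fin.<-cmp s t
    ... | tri< s<t _ _ = ⊥-elim (intervals-distinct 1≤k k<n s<t Is≡It)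
    ... | tri≈ _ s≡t _ = s≡t
    ... | tri> _ _ t<s = ⊥-elim (intervals-distinct 1≤k k<n t<s (sym Is≡It))

  interval-full : ∀ {n} (s t : Fin n) → interval n n s ≡ interval n n t
  interval-full {n} s t = begin
    interval n n s                     ≡⟨ tabulate∘lookup (interval n n s) ⟨
    Vec.tabulate (_∈ᵇ interval n n s)  ≡⟨ tabulate-cong (λ j → trans (full s j) (sym (full t j))) ⟩
    Vec.tabulate (_∈ᵇ interval n n t)  ≡⟨ tabulate∘lookup (interval n n t) ⟩
    interval n n t                     ∎
    where
    open ≡-Reasoning
    full : ∀ s j → j ∈ᵇ interval n n s ≡ true
    full s j = Equivalence.to T-≡ (∈-interval⁺ n s j (InArc-full (toℕ<n j)))

  -- The family 𝒜

  module _ {A : Set} (_≟_ : DecidableEquality A) where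

    deduplicate-unique : ∀ {xs} → Unique xs → deduplicate _≟_ xs ≡ xs
    deduplicate-unique []           = refl
    deduplicate-unique {x ∷ _} (x∉xs ∷ xs!) =
      cong (x ∷_) (trans (cong (filter (¬? ∘ (x ≟_))) (deduplicate-unique xs!)) (filter-all (¬? ∘ (x ≟_)) x∉xs))

    deduplicate-constant : ∀ {x xs} → All (x ≡_) xs → deduplicate _≟_ (x ∷ xs) ≡ x ∷ []
    deduplicate-constant {x} x≡xs =
      cong (x ∷_) (filter-none (¬? ∘ (x ≟_)) (All.map (λ x≡y x≢y → x≢y x≡y) (deduplicate⁺ _≟_ x≡xs)))

  𝒜-distinct : ∀ {n k} → 1 ≤ k → k < n → 𝒜 n k ≡ map (interval n k) (allFin n)
  𝒜-distinct 1≤k k<n = deduplicate-unique (≡-dec _≟ᵇ_) (Unique.map⁺ (interval-injective 1≤k k<n) (allFin⁺ _))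

  𝒜-full : ∀ n → 𝒜 (suc n) (suc n) ≡ interval (suc n) (suc n) zero ∷ []
  𝒜-full n = deduplicate-constant (≡-dec _≟ᵇ_) (All.map⁺ (All.universal (interval-full zero) (tabulate suc)))

  intervals-degree-bounded : ∀ {n k} → k ≤ n → DegreeBoundedBy (map (interval n k) (allFin n)) 2
  intervals-degree-bounded {n} {k} k≤n {S} S∈V {i} _ with ∈-map⁻ (interval n k) S∈V
  ... | s , _ , refl = begin
    degree V (I s)
      ≡⟨ countB-map (meets (I s)) I (allFin n) ⟩
    countB (λ t → meets (I s) (I t)) (allFin n)
      ≤⟨ countB-≤-+ (meets-interval s) (allFin n) ⟩
    countB (λ t → s ∈ᵇ I t) (allFin n) + countB (_∈ᵇ I s) (allFin n)
      ≤⟨ +-mono-≤ (≤-reflexive (count-interval-containing k≤n s)) (count-interval-members s) ⟩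
    k + k
      ≡⟨ cong (k +_) (+-identityʳ k) ⟨
    2 * k
      ≡⟨ cong (2 *_) (trans (countB-map (i ∈ᵇ_) I (allFin n)) (count-interval-containing k≤n i)) ⟨
    2 * coverage V i
      ∎
    where
    open ≤-Reasoning
    I : Fin n → Subset n
    I = interval n k
    V : List (Subset n)
    V = map I (allFin n)

  singleton-degree-bounded : ∀ {n} {S : Subset n} → DegreeBoundedBy (S ∷ []) 2
  singleton-degree-bounded {S = S} (here refl) {i} i∈S = begin
    degree (S ∷ []) S         ≡⟨ countB-∷ (meets S) S [] ⟩
    bit (meets S S) + 0       ≤⟨ +-monoˡ-≤ 0 (bit≤1 (meets S S)) ⟩
    1                         ≤⟨ m≤n*m 1 2 ⟩
    2 * 1                     ≡⟨ cong (λ x → 2 * (x + 0)) (bit-true i∈S) ⟨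
    2 * (bit (i ∈ᵇ S) + 0)    ≡⟨ cong (2 *_) (countB-∷ (i ∈ᵇ_) S []) ⟨
    2 * coverage (S ∷ []) i   ∎
    where open ≤-Reasoning

  𝒜-degree-bounded : ∀ {n k} → 1 ≤ k → k ≤ n → DegreeBoundedBy (𝒜 n k) 2
  𝒜-degree-bounded 1≤k k≤n with m≤n⇒m<n∨m≡n k≤n
  ... | inj₁ k<n  = subst (λ V → DegreeBoundedBy V 2) (sym (𝒜-distinct 1≤k k<n)) (intervals-degree-bounded k≤n)
  ... | inj₂ refl = full 1≤k
    where
    full : ∀ {n} → 1 ≤ n → DegreeBoundedBy (𝒜 n n) 2
    full {suc n} _ = subst (λ V → DegreeBoundedBy V 2) (sym (𝒜-full n)) singleton-degree-bounded

open DirectProductTesting using (dist-majority-≤; 𝒜-degree-bounded)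
open import Data.Nat using (ℕ; _≤_; s≤s; z≤n)
open import Data.Fin using (Fin)
open import Data.Bool using (Bool)
open import Data.Rational using (ℚ; 0ℚ; 1ℚ; _-_; _*_; _/_) renaming (_≤_ to _≤ℚ_)
open import Data.Integer using (+_)
open import Relation.Binary.PropositionalEquality using (_≡_)

theorem5p1 : (n k : ℕ) → 1 ≤ k → k ≤ n →
    (ε : ℚ) → 0ℚ ≤ℚ ε → (F : Assignment n) →
    acceptProb (𝒜 n k) F ≡ 1ℚ - ε →
    (a : Fin n → Bool) → IsMajority (𝒜 n k) F a →
    dist (𝒜 n k) F (DP a) ≤ℚ (((+ 4) / 1) * ε)
theorem5p1 n k 1≤k k≤n ε ε≥0 F accept a majority =
  dist-majority-≤ (𝒜 n k) F a {c = 2} (s≤s z≤n) (𝒜-degree-bounded 1≤k k≤n) majority ε≥0 accept
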